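{- Fix an integer $k\ge 2$ and consider either edge connectivity or vertex connectivity. Let $G=(V,E)$ and $H=(V_H,E_H)$ be directed graphs and let $A\subseteq V_H\cap V$ be such that for every $u\in A$ the set of incoming edges of $u$ in $H$ equals that in $G$. Then for a set of vertices $T\subseteq A$ and a set of elements $Z$, $T$ induces a $k$-almost top SCC with respect to $Z$ in $H$ if and only if $T$ induces a $k$-almost top SCC with respect to $Z$ in $G$.
   Context: Elements are edges (edge connectivity) or vertices (vertex connectivity); $G\setminus Z$ denotes $G$ with the elements of $Z$ removed. A top SCC (tSCC) is a strongly connected component with no incoming edges from outside it. $T$ induces a $k$-almost tSCC with respect to $Z$ in a graph $G$ if $|Z|<k$, $G[T]$ is a tSCC of $G\setminus Z$, and in $G$, for vertex connectivity, $T$ has an incoming edge from each vertex of $Z$, and for edge connectivity every edge of $Z$ is an edge from $V\setminus T$ into $T$. -}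

module Defs where

open import Data.Nat using (ℕ; _<_)
open import Data.List using (List; length)
open import Data.List.Membership.Propositional using (_∈_; _∉_)
open import Data.Product using (Σ; ∃; _×_; _,_)
open import Relation.Binary.PropositionalEquality using (_≡_)
open import Relation.Nullary using (¬_)

data Conn : Set where
  edgeConn vertexConn : Conn

-- This models directed
-- multigraphs in which two graphs G, H may share vertices and edges.
module Universe (U Ed : Set) (src tgt : Ed → U) where

  record Digraph : Set where
    field
      V  : List U
      E  : List Ed
      wf : ∀ e → e ∈ E → (src e ∈ V) × (tgt e ∈ V)
  open Digraph public

  record PGraph : Set₁ where
    field
      Vt : U → Set
      Et : Ed → Set
  open PGraph public

  Elem : Conn → Set
  Elem edgeConn   = Ed
  Elem vertexConn = U

  remove : (c : Conn) → Digraph → List (Elem c) → PGraph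
  remove edgeConn   G Z = record { Vt = λ v → v ∈ V G ; Et = λ e → (e ∈ E G) × (e ∉ Z) }
  remove vertexConn G Z = record { Vt = λ v → (v ∈ V G) × (v ∉ Z)
                                 ; Et = λ e → (e ∈ E G) × (src e ∉ Z) × (tgt e ∉ Z) }

  data Reach (P : PGraph) : U → U → Set where
    here : ∀ {u} → Vt P u → Reach P u u
    step : ∀ {u v} (e : Ed) → Et P e → src e ≡ u → Reach P (tgt e) v → Reach P u v

  IsSCC : PGraph → (U → Set) → Set
  IsSCC P C =
    (∃ λ u → C u)
    × (∀ u → C u → Vt P u)
    × (∀ u v → C u → C v → Reach P u v)
    × (∀ u w → C u → Vt P w → Reach P u w → Reach P w u → C w)

  NoIncoming : PGraph → (U → Set) → Set
  NoIncoming P C = ∀ e → Et P e → C (tgt e) → C (src e)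

  IsTopSCC : PGraph → (U → Set) → Set
  IsTopSCC P C = IsSCC P C × NoIncoming P C

  ZCond : (c : Conn) → Digraph → (U → Set) → List (Elem c) → Set
  ZCond vertexConn G T Z = ∀ z → z ∈ Z → Σ Ed λ e → (e ∈ E G) × (src e ≡ z) × T (tgt e)
  ZCond edgeConn   G T Z = ∀ z → z ∈ Z → (z ∈ E G) × (src z ∈ V G) × ¬ T (src z) × T (tgt z)

  AlmostTSCC : (c : Conn) → ℕ → Digraph → (U → Set) → List (Elem c) → Set
  AlmostTSCC c k G T Z = (length Z < k) × IsTopSCC (remove c G Z) T × ZCond c G T Z

-- A top SCC T of G \ Z has no incoming edges from outside T, so every path ending in T lies
-- entirely inside T.  Hence strong connectivity, maximality, the absence of incoming edges and
-- the condition on Z only ever inspect edges whose head is in T ⊆ A, and on those G and H agree.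
module Submission where

open import Defs
open import Data.Nat using (ℕ; _≤_)
open import Data.List using (List)
open import Data.List.Membership.Propositional using (_∈_)
open import Data.List.Relation.Unary.Unique.Propositional using (Unique)
open import Data.Product using (_×_; _,_; proj₁; proj₂)
open import Relation.Binary.PropositionalEquality using (_≡_; refl)
open import Function.Bundles using (_⇔_; mk⇔; Equivalence)

module Transfer (U Ed : Set) (src tgt : Ed → U) where
  open Universe U Ed src tgt

  EdgesInto⊆ : (U → Set) → PGraph → PGraph → Set
  EdgesInto⊆ T P Q = ∀ e → T (tgt e) → Et P e → Et Q e

  noIncoming-reach⁻ : ∀ {P T} → NoIncoming P T → ∀ {u v} → Reach P u v → T v → T u
  noIncoming-reach⁻ ni (here _)           tv = tv
  noIncoming-reach⁻ ni (step e et refl r) tv = ni e et (noIncoming-reach⁻ ni r tv)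

  reach-transfer : ∀ {P Q T} → NoIncoming P T → (∀ u → T u → Vt Q u) → EdgesInto⊆ T P Q →
                   ∀ {u v} → Reach P u v → T v → Reach Q u v
  reach-transfer ni T⊆Q P⊆Q (here _) tv = here (T⊆Q _ tv)
  reach-transfer ni T⊆Q P⊆Q (step e et eq r) tv =
    step e (P⊆Q e (noIncoming-reach⁻ ni r tv) et) eq (reach-transfer ni T⊆Q P⊆Q r tv)

  isTopSCC-transfer : ∀ {P Q T} → (∀ u → T u → Vt Q u) →
                      EdgesInto⊆ T P Q → EdgesInto⊆ T Q P → IsTopSCC P T → IsTopSCC Q T
  isTopSCC-transfer {P} {Q} {T} T⊆Q P⊆Q Q⊆P ((nonempty , _ , strong , _) , niP) =
    (nonempty , T⊆Q , strongQ , maximalQ) , niQ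
    where
    niQ : NoIncoming Q T
    niQ e et t = niP e (Q⊆P e t et) t
    strongQ : ∀ u v → T u → T v → Reach Q u v
    strongQ u v tu tv = reach-transfer niP T⊆Q P⊆Q (strong u v tu tv) tv
    maximalQ : ∀ u w → T u → Vt Q w → Reach Q u w → Reach Q w u → T w
    maximalQ u w tu _ _ w↝u = noIncoming-reach⁻ niQ w↝u tu

  InEdges⊆ : (U → Set) → Digraph → Digraph → Set
  InEdges⊆ A H G = ∀ e → A (tgt e) → e ∈ E H → e ∈ E G

  remove-edgesInto⊆ : ∀ c {A T : U → Set} {H G} → (∀ u → T u → A u) → InEdges⊆ A H G →
                      (Z : List (Elem c)) → EdgesInto⊆ T (remove c H Z) (remove c G Z)
  remove-edgesInto⊆ edgeConn   T⊆A H⊆G Z e t (e∈H , e∉Z) = H⊆G e (T⊆A _ t) e∈H , e∉Z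
  remove-edgesInto⊆ vertexConn T⊆A H⊆G Z e t (e∈H , ends∉Z) = H⊆G e (T⊆A _ t) e∈H , ends∉Z

  remove-Vt-transfer : ∀ c {T : U → Set} {H G} → (∀ u → T u → u ∈ V G) → (Z : List (Elem c)) →
                     (∀ u → T u → Vt (remove c H Z) u) → ∀ u → T u → Vt (remove c G Z) u
  remove-Vt-transfer edgeConn   T⊆G Z _   u t = T⊆G u t
  remove-Vt-transfer vertexConn T⊆G Z T⊆H u t = T⊆G u t , proj₂ (T⊆H u t)

  zCond-transfer : ∀ c {A T : U → Set} {H G} → (∀ u → T u → A u) → InEdges⊆ A H G →
                   (Z : List (Elem c)) → ZCond c H T Z → ZCond c G T Z
  zCond-transfer vertexConn T⊆A H⊆G Z zc z z∈Z with zc z z∈Z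
  ... | e , e∈H , src≡z , t = e , H⊆G e (T⊆A _ t) e∈H , src≡z , t
  zCond-transfer edgeConn {G = G} T⊆A H⊆G Z zc z z∈Z with zc z z∈Z
  ... | z∈H , _ , ¬ts , t = z∈G , proj₁ (wf G z z∈G) , ¬ts , t
    where
    z∈G : z ∈ E G
    z∈G = H⊆G z (T⊆A _ t) z∈H

  almostTSCC-transfer : ∀ c k {A T : U → Set} {H G} → (∀ u → T u → A u) → (∀ u → A u → u ∈ V G) →
                        InEdges⊆ A H G → InEdges⊆ A G H →
                        (Z : List (Elem c)) → AlmostTSCC c k H T Z → AlmostTSCC c k G T Z
  almostTSCC-transfer c k {T = T} {G = G} T⊆A A⊆G H⊆G G⊆H Z (|Z|<k , tscc@((_ , T⊆H∖Z , _) , _) , zc) =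
    |Z|<k ,
    isTopSCC-transfer T⊆G∖Z (remove-edgesInto⊆ c T⊆A H⊆G Z) (remove-edgesInto⊆ c T⊆A G⊆H Z) tscc ,
    zCond-transfer c T⊆A H⊆G Z zc
    where
    T⊆G∖Z : ∀ u → T u → Vt (remove c G Z) u
    T⊆G∖Z = remove-Vt-transfer c (λ u t → A⊆G u (T⊆A u t)) Z T⊆H∖Z

mainTheorem11 : (U Ed : Set) (src tgt : Ed → U) (k : ℕ) → 2 ≤ k → (c : Conn) →
    let open Universe U Ed src tgt in
    (G H : Digraph) → (A : U → Set) →
    (∀ u → A u → (u ∈ V H) × (u ∈ V G)) →
    (∀ u → A u → ∀ e → tgt e ≡ u → (e ∈ E H ⇔ e ∈ E G)) →
    (T : U → Set) → (∀ u → T u → A u) →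
    (Z : List (Elem c)) → Unique Z →
    (AlmostTSCC c k H T Z ⇔ AlmostTSCC c k G T Z)
mainTheorem11 U Ed src tgt k _ c G H A A⊆V inEdges T T⊆A Z _ =
  mk⇔ (almostTSCC-transfer c k T⊆A (λ u a → proj₂ (A⊆V u a)) H⊆G G⊆H Z)
      (almostTSCC-transfer c k T⊆A (λ u a → proj₁ (A⊆V u a)) G⊆H H⊆G Z)
  where
  open Transfer U Ed src tgt
  H⊆G : InEdges⊆ A H G
  H⊆G e a = Equivalence.to (inEdges _ a e refl)
  G⊆H : InEdges⊆ A G H
  G⊆H e a = Equivalence.from (inEdges _ a e refl)
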